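{- Let $\mathcal{B}$ and $\mathcal{T}$ be finite nonempty sets, let $\mathcal{L}=\{1,\dots,|\mathcal{P}|\}$ index a finite set of power values $\mathcal{P}=\{P_1,\dots,P_{|\mathcal{P}|}\}$ with $P_l>0$ for all $l$ and $P_{max}=\max_{l\in\mathcal L}P_l$, let $a_{tb}>0$ ($t\in\mathcal T$, $b\in\mathcal B$), $\mu>0$, $\delta>0$, and let $\alpha$ be an integer with $0\le\alpha\le|\mathcal T|$. For $t\in\mathcal T$, $\beta\in\mathcal B$ put $$M_{t\beta}=\delta\mu+\delta P_{max}\sum_{b\in\mathcal B\setminus\{\beta\}}a_{tb}.$$ Let $S$ be the set of all binary vectors $(x,z)$, with $x=(x_{tb})_{t\in\mathcal T,b\in\mathcal B}\in\{0,1\}^{\mathcal T\times\mathcal B}$ and $z=(z_{bl})_{b\in\mathcal B,l\in\mathcal L}\in\{0,1\}^{\mathcal B\times\mathcal L}$, satisfying (i) $a_{t\beta}\sum_{l\in\mathcal L}P_l z_{\beta l}-\delta\sum_{b\in\mathcal B\setminus\{\beta\}}a_{tb}\sum_{l\in\mathcal L}P_l z_{bl}\ \ge\ \delta\mu-M_{t\beta}(1-x_{t\beta})$ for all $t\in\mathcal T,\beta\in\mathcal B$; (ii) $\sum_{b\in\mathcal B}\sum_{t\in\mathcal T}x_{tb}\ge\alpha$; (iii) $\sum_{b\in\mathcal B}x_{tb}\le 1$ for all $t\in\mathcal T$; (iv) $\sum_{l\in\mathcal L}z_{bl}\le 1$ for all $b\in\mathcal B$; (v) $x_{tb}\le\sum_{l\in\mathcal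 L}z_{bl}$ for all $t\in\mathcal T$, $b\in\mathcal B$. Then the inequalities $$w_{tb}\le 1-x_{tb}\quad (t\in\mathcal T,\ b\in\mathcal B),\qquad w_{tb}\in\{0,1\},$$ $$M_{t\beta}w_{t\beta}\ \ge\ \delta\sum_{b\in\mathcal B\setminus\{\beta\}}a_{tb}\sum_{l\in\mathcal L}P_l z_{bl}-a_{t\beta}\sum_{l\in\mathcal L}P_l z_{\beta l}+\delta\mu\quad (t\in\mathcal T,\ \beta\in\mathcal B)$$ in the additional binary variables $w=(w_{tb})_{t\in\mathcal T,b\in\mathcal B}$ are valid for $S$: for every $(x,z)\in S$ there exists $w\in\{0,1\}^{\mathcal T\times\mathcal B}$ such that $(x,w,z)$ satisfies all of these inequalities.
   Context: This is the site and power assignment problem in wireless network design: $\mathcal B$ is the set of candidate transmitters, $\mathcal T$ the set of testpoints (receivers), $z_{bl}=1$ means transmitter $b$ emits at power $P_l$, $x_{tb}=1$ means testpoint $t$ is served by transmitter $b$, $a_{tb}$ is the fading coefficient, $\mu$ the noise, $\delta$ the SINR threshold. Constraint (i) is the big-$M$ form of the SINR condition; the new variables $w_{tb}$ are auxiliary binary variables used in a reformulation in which (i) is replaced by the stated inequalities.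
   Formalization: The power values $P_l$, the fading coefficients $a_{tb}$, the noise $\mu$ and the SINR threshold $\delta$ are rational numbers. -}

module Defs where

open import Data.Nat using (ℕ; zero; suc)
open import Data.Fin using (Fin; zero; suc)
open import Data.Fin.Properties using (_≟_)
open import Data.Bool using (Bool; true; false)
open import Data.Rational using (ℚ; 0ℚ; 1ℚ; _+_; _*_; _⊔_)
open import Relation.Nullary using (yes; no)

⟦_⟧ : Bool → ℚ
⟦ true ⟧  = 1ℚ
⟦ false ⟧ = 0ℚ

Σ : (n : ℕ) → (Fin n → ℚ) → ℚ
Σ zero    f = 0ℚ
Σ (suc n) f = f zero + Σ n (λ i → f (suc i))

Σ-except : (n : ℕ) → Fin n → (Fin n → ℚ) → ℚ
Σ-except n β f = Σ n (λ b → g b)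
  where
  g : Fin n → ℚ
  g b with b ≟ β
  ... | yes _ = 0ℚ
  ... | no  _ = f b

Max : (n : ℕ) → (Fin (suc n) → ℚ) → ℚ
Max zero    f = f zero
Max (suc n) f = f zero ⊔ Max n (λ i → f (suc i))

{-# OPTIONS --safe #-}
module Submission where

-- Take w = 1 - x. Then w ≤ 1 - x holds with equality, and the big-M inequality
-- for w is constraint (i) with its two sides rearranged.

open import Defs
open import Data.Nat using (ℕ; suc)
open import Data.Fin using (Fin)
open import Data.Bool using (Bool; true; false; not)
open import Data.Product using (Σ-syntax; _×_; _,_)
open import Data.Integer using (+_)
open import Data.Rational using (ℚ; 1ℚ; _+_; _*_; _-_; _≤_; _<_; 0ℚ; _/_)
open import Data.Rational.Properties using (+-monoˡ-≤; ≤-reflexive; module ≤-Reasoning)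
open import Data.Rational.Solver using (module +-*-Solver)
open import Relation.Binary.PropositionalEquality using (_≡_; refl; sym; subst)

open +-*-Solver using (solve; _:+_; _:-_; _:=_)

⟦not⟧≡1-⟦⟧ : ∀ b → ⟦ not b ⟧ ≡ 1ℚ - ⟦ b ⟧
⟦not⟧≡1-⟦⟧ true  = refl
⟦not⟧≡1-⟦⟧ false = refl

c-K≤A-D⇒D-A+c≤K : ∀ A D c K → c - K ≤ A - D → D - A + c ≤ K
c-K≤A-D⇒D-A+c≤K A D c K c-K≤A-D = begin
  D - A + c            ≡⟨ solve 4 (λ A D c K → D :- A :+ c := (c :- K) :+ (D :- A :+ K)) refl A D c K ⟩
  c - K + (D - A + K)  ≤⟨ +-monoˡ-≤ (D - A + K) c-K≤A-D ⟩
  A - D + (D - A + K)  ≡⟨ solve 4 (λ A D c K → (A :- D) :+ (D :- A :+ K) := K) refl A D c K ⟩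
  K                    ∎
  where open ≤-Reasoning

bigM-complement : ∀ A D c M b →
  c - M * (1ℚ - ⟦ b ⟧) ≤ A - D → D - A + c ≤ M * ⟦ not b ⟧
bigM-complement A D c M b sinr =
  subst (λ u → D - A + c ≤ M * u) (sym (⟦not⟧≡1-⟦⟧ b))
    (c-K≤A-D⇒D-A+c≤K A D c (M * (1ℚ - ⟦ b ⟧)) sinr)

theorem1 : (nB nT nL : ℕ)
    → (P : Fin (suc nL) → ℚ) → (∀ l → 0ℚ < P l)
    → (a : Fin (suc nT) → Fin (suc nB) → ℚ) → (∀ t b → 0ℚ < a t b)
    → (μ δ : ℚ) → 0ℚ < μ → 0ℚ < δ
    → (α : ℕ) → α Data.Nat.≤ suc nT
    → (x : Fin (suc nT) → Fin (suc nB) → Bool)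
    → (z : Fin (suc nB) → Fin (suc nL) → Bool)
    → (∀ t β →
        a t β * Σ (suc nL) (λ l → P l * ⟦ z β l ⟧)
          - δ * Σ-except (suc nB) β (λ b → a t b * Σ (suc nL) (λ l → P l * ⟦ z b l ⟧))
        Data.Rational.≥
        δ * μ - (δ * μ + δ * Max nL P * Σ-except (suc nB) β (λ b → a t b))
                  * (1ℚ - ⟦ x t β ⟧))
    → (+ α / 1) ≤ Σ (suc nB) (λ b → Σ (suc nT) (λ t → ⟦ x t b ⟧))
    → (∀ t → Σ (suc nB) (λ b → ⟦ x t b ⟧) ≤ 1ℚ)
    → (∀ b → Σ (suc nL) (λ l → ⟦ z b l ⟧) ≤ 1ℚ)
    → (∀ t b → ⟦ x t b ⟧ ≤ Σ (suc nL) (λ l → ⟦ z b l ⟧))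
    → Σ[ w ∈ (Fin (suc nT) → Fin (suc nB) → Bool) ]
        ((∀ t b → ⟦ w t b ⟧ ≤ 1ℚ - ⟦ x t b ⟧)
        × (∀ t β →
            δ * Σ-except (suc nB) β (λ b → a t b * Σ (suc nL) (λ l → P l * ⟦ z b l ⟧))
              - a t β * Σ (suc nL) (λ l → P l * ⟦ z β l ⟧) + δ * μ
            ≤ (δ * μ + δ * Max nL P * Σ-except (suc nB) β (λ b → a t b)) * ⟦ w t β ⟧))
theorem1 nB nT nL P _ a _ μ δ _ _ α _ x z sinr _ _ _ _ =
  w , (λ t b → ≤-reflexive (⟦not⟧≡1-⟦⟧ (x t b))) ,
  λ t β → bigM-complement (signal t β) (interference t β) (δ * μ) (bigM t β) (x t β) (sinr t β)
  where
  w : Fin (suc nT) → Fin (suc nB) → Bool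
  w t b = not (x t b)

  signal interference bigM : Fin (suc nT) → Fin (suc nB) → ℚ
  signal t β       = a t β * Σ (suc nL) (λ l → P l * ⟦ z β l ⟧)
  interference t β = δ * Σ-except (suc nB) β (λ b → a t b * Σ (suc nL) (λ l → P l * ⟦ z b l ⟧))
  bigM t β         = δ * μ + δ * Max nL P * Σ-except (suc nB) β (λ b → a t b)
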